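{- Let $\mathcal{M}=(X,\vec{\mathcal{C}},\mathcal{V})$ be a quasi-discrete closure model. Then for all $x_1,x_2\in X$: $x_1$ and $x_2$ are CM-bisimilar in $\mathcal{M}$ if and only if $x_1$ and $x_2$ satisfy exactly the same ${\tt IML}$ formulas in $\mathcal{M}$. That is, ${\tt IML}$-equivalence coincides with CM-bisimilarity on $\mathcal{M}$.
   Context: Fix a set $\mathtt{AP}$ of atomic proposition letters. A closure space is a pair $(X,\mathcal{C})$ with $\mathcal{C}:\mathcal{P}(X)\to\mathcal{P}(X)$ such that $\mathcal{C}(\emptyset)=\emptyset$, $A\subseteq\mathcal{C}(A)$ and $\mathcal{C}(A_1\cup A_2)=\mathcal{C}(A_1)\cup\mathcal{C}(A_2)$ for all $A,A_1,A_2\subseteq X$. For a relation $R\subseteq X\times X$ let $\mathcal{C}_R(A)=A\cup\{x\in X:\exists a\in A,\ (a,x)\in R\}$. A quasi-discrete closure model is a triple $\mathcal{M}=(X,\vec{\mathcal{C}},\mathcal{V})$ where $\vec{\mathcal{C}}=\mathcal{C}_R$ for some relation $R\subseteq X\times X$ and $\mathcal{V}:\mathtt{AP}\to\mathcal{P}(X)$. The interior is $\mathcal{I}(A)=X\setminus\vec{\mathcal{C}}(X\setminus A)$. A symmetric relation $B\subseteq X\times X$ is a CM-bisimulation if whenever $(x_1,x_2)\in B$: (1) for all $p\in\mathtt{AP}$, $x_1\in\mathcal{V}(p)$ iff $x_2\in\mathcal{V}(p)$; (2) for every $S_1\subseteq X$ with $x_1\in\mathcal{I}(S_1)$ there is $S_2\subseteq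 X$ with $x_2\in\mathcal{I}(S_2)$ such that for each $s_2\in S_2$ there is $s_1\in S_1$ with $(s_1,s_2)\in B$. Points are CM-bisimilar if some CM-bisimulation contains the pair. The logic ${\tt IML}$ has formulas $\Phi::=p\mid\neg\Phi\mid\bigwedge_{i\in I}\Phi_i\mid\mathcal{N}\Phi$ ($p\in\mathtt{AP}$, $I$ an arbitrary index set), with $x\models p$ iff $x\in\mathcal{V}(p)$, the usual clauses for negation and conjunction, and $x\models\mathcal{N}\Phi$ iff $x\in\vec{\mathcal{C}}(\{y\in X: y\models\Phi\})$. -}

module Defs where

open import Level using (0ℓ)
open import Data.Product using (Σ; _×_; _,_)
open import Data.Sum using (_⊎_)
open import Relation.Nullary using (¬_)
open import Function.Bundles using (_⇔_)

Subset : Set → Set₁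
Subset X = X → Set

𝒞[_] : {X : Set} → (X → X → Set) → Subset X → Subset X
𝒞[_] {X} R A x = A x ⊎ Σ X (λ a → A a × R a x)

record QDCM (AP : Set) : Set₁ where
  field
    X : Set
    R : X → X → Set
    V : AP → Subset X

  C⃗ : Subset X → Subset X
  C⃗ = 𝒞[ R ]

  𝓘 : Subset X → Subset X
  𝓘 A x = ¬ C⃗ (λ y → ¬ A y) x

data IML (AP : Set) : Set₁ where
  atom : AP → IML AP
  ¬ᶠ_  : IML AP → IML AP
  ⋀    : (I : Set) → (I → IML AP) → IML AP
  𝓝    : IML AP → IML AP

module _ {AP : Set} (M : QDCM AP) where
  open QDCM M

  _⊨_ : X → IML AP → Set
  x ⊨ atom p  = V p x
  x ⊨ (¬ᶠ Φ)  = ¬ (x ⊨ Φ)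
  x ⊨ ⋀ I Φs  = (i : I) → x ⊨ Φs i
  x ⊨ 𝓝 Φ     = C⃗ (λ y → y ⊨ Φ) x

  record IsCMBisimulation (B : X → X → Set) : Set₁ where
    field
      symmetric : ∀ {x₁ x₂} → B x₁ x₂ → B x₂ x₁
      atoms     : ∀ {x₁ x₂} → B x₁ x₂ → (p : AP) → (V p x₁ ⇔ V p x₂)
      interior  : ∀ {x₁ x₂} → B x₁ x₂ → (S₁ : Subset X) → 𝓘 S₁ x₁ →
                  Σ (Subset X) (λ S₂ → 𝓘 S₂ x₂ ×
                    ((s₂ : X) → S₂ s₂ → Σ X (λ s₁ → S₁ s₁ × B s₁ s₂)))

  CM-bisimilar : X → X → Set₁
  CM-bisimilar x₁ x₂ = Σ (X → X → Set) (λ B → IsCMBisimulation B × B x₁ x₂)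

  IML-equivalent : X → X → Set₁
  IML-equivalent x₁ x₂ = (Φ : IML AP) → (x₁ ⊨ Φ ⇔ x₂ ⊨ Φ)

-- A CM-bisimulation preserves every formula: the only nontrivial case is 𝓝Φ, where the
-- interior clause moves the interior of ∁⟦Φ⟧ from one point to the other.  Conversely,
-- IML-equivalence (resized to Set by excluded middle) is itself a CM-bisimulation: for
-- x₁ ∈ 𝓘 S₁, let S₂ be the points equivalent to some point of S₁.  If x₂ were in the
-- closure of ∁S₂, one infinitary formula Ψ true on ∁S₂ and false on S₁ would give
-- x₂ ⊨ 𝓝Ψ, hence x₁ ⊨ 𝓝Ψ, putting x₁ in the closure of ∁S₁.
module Submission where

open import Defs
open import Level using (0ℓ; lift; lower)
open import Axiom.ExcludedMiddle using (ExcludedMiddle)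
open import Axiom.DoubleNegationElimination using (DoubleNegationElimination; em⇒dne)
open import Function.Bundles using (_⇔_; mk⇔; Equivalence)
open import Function.Construct.Symmetry using (⇔-sym)
open import Data.Product using (Σ; _×_; _,_; proj₁; proj₂)
open import Data.Sum using (inj₁; inj₂)
open import Relation.Nullary using (¬_)
open import Relation.Nullary.Decidable using (True; toWitness; fromWitness)
open import Relation.Unary using (_⊆_; ∁)

𝒞-mono : {X : Set} (R : X → X → Set) {A B : Subset X} → A ⊆ B → 𝒞[ R ] A ⊆ 𝒞[ R ] B
𝒞-mono R A⊆B (inj₁ Ax) = inj₁ (A⊆B Ax)
𝒞-mono R A⊆B (inj₂ (a , Aa , Rax)) = inj₂ (a , A⊆B Aa , Rax)

⋁ : {AP : Set} (I : Set) → (I → IML AP) → IML AP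
⋁ I Φs = ¬ᶠ ⋀ I (λ i → ¬ᶠ Φs i)

module _ {AP : Set} (M : QDCM AP) where
  open QDCM M

  ⟦_⟧ : IML AP → Subset X
  ⟦ Φ ⟧ x = _⊨_ M x Φ

  𝓘-mono : {A B : Subset X} → A ⊆ B → 𝓘 A ⊆ 𝓘 B
  𝓘-mono A⊆B 𝓘A C∁B = 𝓘A (𝒞-mono R (λ ∁Bx Ax → ∁Bx (A⊆B Ax)) C∁B)

  𝓘∁⇒¬𝒞 : {A : Subset X} {x : X} → 𝓘 (∁ A) x → ¬ C⃗ A x
  𝓘∁⇒¬𝒞 𝓘∁A CA = 𝓘∁A (𝒞-mono R (λ Ax ∁Ax → ∁Ax Ax) CA)

  ⋁-intro : {I : Set} {Φs : I → IML AP} {x : X} (i : I) → ⟦ Φs i ⟧ x → ⟦ ⋁ I Φs ⟧ x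
  ⋁-intro i Φᵢx none = none i Φᵢx

  ⋁-none : {I : Set} {Φs : I → IML AP} {x : X} → (∀ i → ¬ ⟦ Φs i ⟧ x) → ¬ ⟦ ⋁ I Φs ⟧ x
  ⋁-none none ⋁x = ⋁x none

module Classical (em : ExcludedMiddle (Level.suc 0ℓ)) {AP : Set} (M : QDCM AP) where
  open QDCM M

  dne₁ : DoubleNegationElimination (Level.suc 0ℓ)
  dne₁ = em⇒dne em

  dne : DoubleNegationElimination 0ℓ
  dne ¬¬P = lower (dne₁ (λ ¬LP → ¬¬P (λ p → ¬LP (lift p))))

  ¬𝒞⇒𝓘∁ : {A : Subset X} {x : X} → ¬ C⃗ A x → 𝓘 (∁ A) x
  ¬𝒞⇒𝓘∁ ¬CA C∁∁A = ¬CA (𝒞-mono R dne C∁∁A)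

  module _ {B : X → X → Set} (bis : IsCMBisimulation M B) where
    open IsCMBisimulation bis

    bisimulation-preserves : (Φ : IML AP) {x y : X} → B x y → ⟦ M ⟧ Φ x → ⟦ M ⟧ Φ y
    bisimulation-preserves (atom p) Bxy = Equivalence.to (atoms Bxy p)
    bisimulation-preserves (¬ᶠ Φ) Bxy ¬Φx Φy = ¬Φx (bisimulation-preserves Φ (symmetric Bxy) Φy)
    bisimulation-preserves (⋀ I Φs) Bxy Φsx i = bisimulation-preserves (Φs i) Bxy (Φsx i)
    bisimulation-preserves (𝓝 Φ) Bxy 𝓝Φx = dne λ ¬𝓝Φy →
      let (S , 𝓘Sx , S⊆B⁻¹[∁Φ]) = interior (symmetric Bxy) (∁ (⟦ M ⟧ Φ)) (¬𝒞⇒𝓘∁ ¬𝓝Φy)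
      in 𝓘∁⇒¬𝒞 M (𝓘-mono M (S⊆∁Φ S⊆B⁻¹[∁Φ]) 𝓘Sx) 𝓝Φx
      where
      S⊆∁Φ : {S : Subset X} → ((s : X) → S s → Σ X (λ s′ → ¬ ⟦ M ⟧ Φ s′ × B s′ s)) →
             S ⊆ ∁ (⟦ M ⟧ Φ)
      S⊆∁Φ S⊆B⁻¹[∁Φ] {s} Ss Φs =
        let (s′ , ¬Φs′ , Bs′s) = S⊆B⁻¹[∁Φ] s Ss
        in ¬Φs′ (bisimulation-preserves Φ (symmetric Bs′s) Φs)

  distinguishing-formula : {s t : X} → ¬ IML-equivalent M s t →
                           Σ (IML AP) (λ Φ → ⟦ M ⟧ Φ t × ¬ ⟦ M ⟧ Φ s)
  distinguishing-formula ¬s≡t = dne₁ λ ¬δ → ¬s≡t λ Φ → mk⇔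
    (λ Φs → dne λ ¬Φt → ¬δ (¬ᶠ Φ , ¬Φt , λ ¬Φs → ¬Φs Φs))
    (λ Φt → dne λ ¬Φs → ¬δ (Φ , Φt , ¬Φs))

  -- Ψ = ⋁_{t ∈ T} ⋀_{s ∈ S} δ(s, t): the index sets are subsets of X, so Ψ is a legal formula.
  separating-formula : (S T : Subset X) →
                       (∀ {s t} → S s → T t → ¬ IML-equivalent M s t) →
                       Σ (IML AP) (λ Ψ → T ⊆ ⟦ M ⟧ Ψ × ⟦ M ⟧ Ψ ⊆ ∁ S)
  separating-formula S T S≢T = Ψ , T⊆Ψ , Ψ⊆∁S
    where
    δ : ∀ {s t} → S s → T t → Σ (IML AP) (λ Φ → ⟦ M ⟧ Φ t × ¬ ⟦ M ⟧ Φ s)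
    δ Ss Tt = distinguishing-formula (S≢T Ss Tt)

    ⋀δ : Σ X T → IML AP
    ⋀δ (t , Tt) = ⋀ (Σ X S) λ (s , Ss) → proj₁ (δ Ss Tt)

    Ψ : IML AP
    Ψ = ⋁ (Σ X T) ⋀δ

    T⊆Ψ : T ⊆ ⟦ M ⟧ Ψ
    T⊆Ψ {t} Tt = ⋁-intro M {Φs = ⋀δ} (t , Tt) λ (s , Ss) → proj₁ (proj₂ (δ Ss Tt))

    Ψ⊆∁S : ⟦ M ⟧ Ψ ⊆ ∁ S
    Ψ⊆∁S {s} Ψs Ss = ⋁-none M {Φs = ⋀δ} (λ (t , Tt) ⋀δs → proj₂ (proj₂ (δ Ss Tt)) (⋀δs (s , Ss))) Ψs

  -- IML-equivalence lives in Set₁, while a CM-bisimulation must be Set-valued.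
  _≈_ : X → X → Set
  x ≈ y = True (em {IML-equivalent M x y})

  ≈-isCMBisimulation : IsCMBisimulation M _≈_
  ≈-isCMBisimulation = record
    { symmetric = λ x≈y → fromWitness (λ Φ → ⇔-sym (toWitness x≈y Φ))
    ; atoms     = λ x≈y p → toWitness x≈y (atom p)
    ; interior  = interior
    }
    where
    interior : ∀ {x₁ x₂} → x₁ ≈ x₂ → (S₁ : Subset X) → 𝓘 S₁ x₁ →
               Σ (Subset X) (λ S₂ → 𝓘 S₂ x₂ × ((s₂ : X) → S₂ s₂ → Σ X (λ s₁ → S₁ s₁ × s₁ ≈ s₂)))
    interior {x₁} {x₂} x₁≈x₂ S₁ 𝓘S₁x₁ = S₂ , 𝓘S₂x₂ , λ _ S₂s₂ → S₂s₂
      where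
      S₂ : Subset X
      S₂ s₂ = Σ X (λ s₁ → S₁ s₁ × s₁ ≈ s₂)

      separated : ∀ {s t} → S₁ s → ∁ S₂ t → ¬ IML-equivalent M s t
      separated {s} S₁s ∁S₂t s≡t = ∁S₂t (s , S₁s , fromWitness s≡t)

      𝓘S₂x₂ : 𝓘 S₂ x₂
      𝓘S₂x₂ C∁S₂x₂ =
        let (Ψ , ∁S₂⊆Ψ , Ψ⊆∁S₁) = separating-formula S₁ (∁ S₂) separated
            𝓝Ψx₁ = Equivalence.from (toWitness x₁≈x₂ (𝓝 Ψ)) (𝒞-mono R ∁S₂⊆Ψ C∁S₂x₂)
        in 𝓘S₁x₁ (𝒞-mono R Ψ⊆∁S₁ 𝓝Ψx₁)

theorem3p8 : ExcludedMiddle (Level.suc 0ℓ) →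
    {AP : Set} (M : QDCM AP) (x₁ x₂ : QDCM.X M) →
    CM-bisimilar M x₁ x₂ ⇔ IML-equivalent M x₁ x₂
theorem3p8 em M x₁ x₂ = mk⇔
  (λ (B , bis , Bx₁x₂) Φ →
     mk⇔ (bisimulation-preserves bis Φ Bx₁x₂)
         (bisimulation-preserves bis Φ (IsCMBisimulation.symmetric bis Bx₁x₂)))
  (λ x₁≡x₂ → _≈_ , ≈-isCMBisimulation , fromWitness x₁≡x₂)
  where open Classical em M
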